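{- For all agents $a,b\in A$, the following formulas are valid (true at every gossip state): $b_a\to K_ab_a$, $\neg b_a\to K_a\neg b_a$, $\overline b_a\to K_a\overline b_a$, and $\neg\overline b_a\to K_a\neg\overline b_a$.
   Context: Fix a finite set $A$ of agents, $|A|\ge 2$. Secret values are the elements of $A\times\{0,1\}$; write $b$ for $(b,1)$ and $\overline{b}$ for $(b,0)$. For $B\subseteq A\times\{0,1\}$ and $c\in A$, $B^{\pm c}$ is $B$ with the values $c$ and $\overline c$ swapped: simultaneously, $c$ is replaced by $\overline c$ and $\overline c$ by $c$. A secret distribution is a map $S:A\to\mathcal P(A\times\{0,1\})$, $a\mapsto S_a$ (the holding of $a$). An initial secret distribution $I$ satisfies $I_a\in\{\{a\},\{\overline a\}\}$ for every $a$. Calls: for $a\neq b$ in $A$ and $c\in A$ there is the correct call $ab$ (agent $a$ calls $b$ and they exchange their holdings), the faulty call $a^cb$ (from $a$ to $b$, with a transmission error on secret $c$ in what $a$ sends, so that $b$ receives $a$'s holding with the values of $c$ swapped), and the faulty call $ab^c$ (from $a$ to $b$, with a transmission error on secret $c$ in what $b$ sends to $a$). A call sequence is a finite sequence of calls containing at most one faulty call. $\epsilon$ is the empty sequence and $\sigma.\kappa$ appends the call $\kappa$. A gossip state is a pair $(I,\sigma)$ with $I$ initial and $\sigma$ a call sequence. Formulas: $\varphi::=b_a\mid\overline b_a\mid\neg\varphi\mid\varphi\wedge\varphi\mid K_a\varphi$ with $a,b\in A$. The following three notions are defined by simultaneous recursion on the length of the call sequence and on the structure of formulas. (1) Secret distribution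 after a call sequence. $I[\epsilon]=I$. Let $a\neq b$. If the call $\kappa$ does not involve $a$, then $I[\sigma.\kappa]_a=I[\sigma]_a$. If $\kappa\in\{ab,ba,a^cb,ba^c\}$, let $R=I[\sigma]_b$; if $\kappa\in\{ab^c,b^ca\}$, let $R=I[\sigma]_b^{\pm c}$. Then $I[\sigma.\kappa]_a=(I[\sigma]_a\cup(R\setminus *))\setminus **$, where $*=\{d: I,\sigma\models K_a\overline d_d\}\cup\{\overline d: I,\sigma\models K_a d_d\}$, and $**$ is the set of values $d$ such that $T,\tau\models\overline d_d$ for all gossip states $(T,\tau)$ with $(I,\sigma)\sim_a(T,\tau)$ and $I[\sigma]_b=T[\tau]_b$, together with the values $\overline d$ such that $T,\tau\models d_d$ for all such $(T,\tau)$. When $\kappa\in\{ab^c,b^ca\}$, the condition $I[\sigma]_b=T[\tau]_b$ is replaced by $I[\sigma]_b=T[\tau]_b^{\pm c}$. (2) Observation relation. $\sim_a$ is the equivalence closure of the following clauses, for $b\neq a$ and $e\in A$: - $(I,\epsilon)\sim_a(T,\epsilon)$ iff $I_a=T_a$; - $(I,\sigma.ab)\sim_a(T,\tau.ab)$ iff $(I,\sigma)\sim_a(T,\tau)$ and $I[\sigma]_b=T[\tau]_b$; - $(I,\sigma.ab)\sim_a(T,\tau.a^eb)$ iff $(I,\sigma)\sim_a(T,\tau)$ and $I[\sigma]_b=T[\tau]_b$; - $(I,\sigma.ab)\sim_a(T,\tau.ab^e)$ iff $(I,\sigma)\sim_a(T,\tau)$ and $I[\sigma]_b=T[\tau]_b^{\pm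 e}$; - the same three clauses with $ba,ba^e,b^ea$ in place of $ab,a^eb,ab^e$; - for a call $\kappa$ (correct or faulty) and a correct call $\kappa'$, neither involving $a$: $(I,\sigma.\kappa)\sim_a(T,\tau.\kappa')$ iff $(I,\sigma)\sim_a(T,\tau)$. Only pairs whose components are call sequences are related. (3) Satisfaction. - $I,\sigma\models b_a$ iff $b\in I[\sigma]_a$; - $I,\sigma\models\overline b_a$ iff $\overline b\in I[\sigma]_a$; - the Boolean clauses are standard; - $I,\sigma\models K_a\varphi$ iff $T,\tau\models\varphi$ for all gossip states $(T,\tau)$ with $(T,\tau)\sim_a(I,\sigma)$. A formula is valid if it is true at every gossip state. -}

module Defs where

open import Data.Nat using (ℕ; zero; suc; _+_; _≤_)
open import Data.Fin using (Fin; _≟_)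
open import Data.Bool using (Bool; true; false; not)
open import Data.Maybe using (Maybe; just; nothing)
open import Data.Product using (_×_; _,_)
open import Data.Sum using (_⊎_)
open import Data.Unit using (⊤)
open import Relation.Nullary using (¬_; yes; no)
open import Relation.Binary.PropositionalEquality using (_≡_; _≢_)
open import Relation.Binary.Construct.Closure.Equivalence using (EqClosure)

module Gossip (k : ℕ) where

  Agent : Set
  Agent = Fin k

  -- secret values: (b , true) is b, (b , false) is b̄
  Value : Set
  Value = Agent × Bool

  Holding : Set₁
  Holding = Value → Set

  HEq : Holding → Holding → Set
  HEq B B' = ∀ v → (B v → B' v) × (B' v → B v)

  swapV : Agent → Value → Value
  swapV c (d , x) with d ≟ c
  ... | yes _ = (d , not x)
  ... | no _  = (d , x)

  -- B^{±c}  (v ∈ B^{±c} iff swapV c v ∈ B, swapV being an involution)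
  swapH : Agent → Holding → Holding
  swapH c B v = B (swapV c v)

  tr : Maybe Agent → Holding → Holding
  tr nothing B = B
  tr (just c) B = swapH c B

  -- initial secret distribution: I a = true means I_a = {a}, false means I_a = {ā}
  Init : Set
  Init = Agent → Bool

  data Call : Set where
    call     : Agent → Agent → Call
    errFrom  : Agent → Agent → Agent → Call    -- errFrom a c b is  a^c b
    errTo    : Agent → Agent → Agent → Call    -- errTo a b c   is  a b^c

  Proper : Call → Set
  Proper (call a b) = a ≢ b
  Proper (errFrom a c b) = a ≢ b
  Proper (errTo a b c) = a ≢ b

  isFaulty : Call → ℕ
  isFaulty (call _ _) = 0
  isFaulty (errFrom _ _ _) = 1
  isFaulty (errTo _ _ _) = 1

  Involves : Agent → Call → Set
  Involves a (call x y) = a ≡ x ⊎ a ≡ y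
  Involves a (errFrom x _ y) = a ≡ x ⊎ a ≡ y
  Involves a (errTo x y _) = a ≡ x ⊎ a ≡ y

  IsCorrect : Call → Set
  IsCorrect κ = isFaulty κ ≡ 0

  data CallSeq : ℕ → Set where
    ε   : CallSeq 0
    _∙_ : ∀ {n} → CallSeq n → Call → CallSeq (suc n)

  faults : ∀ {n} → CallSeq n → ℕ
  faults ε = 0
  faults (σ ∙ κ) = faults σ + isFaulty κ

  AllProper : ∀ {n} → CallSeq n → Set
  AllProper ε = ⊤
  AllProper (σ ∙ κ) = AllProper σ × Proper κ

  Valid : ∀ {n} → CallSeq n → Set
  Valid σ = AllProper σ × faults σ ≤ 1

  data Formula : Set where
    sec : Agent → Agent → Bool → Formula   -- sec a b true = b_a , sec a b false = b̄_a
    ¬'_ : Formula → Formula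
    _∧'_ : Formula → Formula → Formula
    K : Agent → Formula → Formula

  _⇒'_ : Formula → Formula → Formula
  φ ⇒' ψ = ¬' (φ ∧' (¬' ψ))

  -- the semantic data at call-sequence length n:
  -- the secret distribution I[σ] and the observation relations ∼_a
  record Model (n : ℕ) : Set₁ where
    field
      dist : Init → CallSeq n → Agent → Holding
      rel  : Agent → Init → CallSeq n → Init → CallSeq n → Set
  open Model public

  sat : ∀ {n} → Model n → Formula → Init → CallSeq n → Set
  sat M (sec a b x) I σ = dist M I σ a (b , x)
  sat M (¬' φ) I σ = ¬ sat M φ I σ
  sat M (φ ∧' ψ) I σ = sat M φ I σ × sat M ψ I σ
  sat M (K a φ) I σ = ∀ T τ → rel M a T τ I σ → sat M φ T τ

  -- the update of a's holding when a receives b's holding (tr m applied)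
  -- I[σ.κ]_a = (I[σ]_a ∪ (R ∖ *)) ∖ **
  upd : ∀ {n} → Model n → Init → CallSeq n → Agent → Agent → Maybe Agent → Holding
  upd M I σ a b m v = (dist M I σ a v ⊎ (tr m (dist M I σ b) v × ¬ star v)) × ¬ starstar v
    where
    star : Value → Set
    star (d , x) = sat M (K a (sec d d (not x))) I σ
    starstar : Value → Set
    starstar (d , x) = ∀ T τ → rel M a I σ T τ
                        → HEq (dist M I σ b) (tr m (dist M T τ b))
                        → sat M (sec d d (not x)) T τ

  distStep : ∀ {n} → Model n → Init → CallSeq n → Call → Agent → Holding
  distStep M I σ (call x y) a with a ≟ x | a ≟ y
  ... | yes _ | _     = upd M I σ a y nothing
  ... | no _  | yes _ = upd M I σ a x nothing
  ... | no _  | no _  = dist M I σ a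
  distStep M I σ (errFrom x c y) a with a ≟ x | a ≟ y
  ... | yes _ | _     = upd M I σ a y nothing
  ... | no _  | yes _ = upd M I σ a x (just c)
  ... | no _  | no _  = dist M I σ a
  distStep M I σ (errTo x y c) a with a ≟ x | a ≟ y
  ... | yes _ | _     = upd M I σ a y (just c)
  ... | no _  | yes _ = upd M I σ a x nothing
  ... | no _  | no _  = dist M I σ a

  GState : ℕ → Set
  GState n = Init × CallSeq n

  data Step {n : ℕ} (M : Model n) (a : Agent) : GState (suc n) → GState (suc n) → Set where
    c-ab : ∀ {I T σ τ b} → Valid (σ ∙ call a b) → Valid (τ ∙ call a b)
         → rel M a I σ T τ → HEq (dist M I σ b) (dist M T τ b)
         → Step M a (I , σ ∙ call a b) (T , τ ∙ call a b)
    c-aeb : ∀ {I T σ τ b e} → Valid (σ ∙ call a b) → Valid (τ ∙ errFrom a e b)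
         → rel M a I σ T τ → HEq (dist M I σ b) (dist M T τ b)
         → Step M a (I , σ ∙ call a b) (T , τ ∙ errFrom a e b)
    c-abe : ∀ {I T σ τ b e} → Valid (σ ∙ call a b) → Valid (τ ∙ errTo a b e)
         → rel M a I σ T τ → HEq (dist M I σ b) (swapH e (dist M T τ b))
         → Step M a (I , σ ∙ call a b) (T , τ ∙ errTo a b e)
    c-ba : ∀ {I T σ τ b} → Valid (σ ∙ call b a) → Valid (τ ∙ call b a)
         → rel M a I σ T τ → HEq (dist M I σ b) (dist M T τ b)
         → Step M a (I , σ ∙ call b a) (T , τ ∙ call b a)
    c-bae : ∀ {I T σ τ b e} → Valid (σ ∙ call b a) → Valid (τ ∙ errTo b a e)
         → rel M a I σ T τ → HEq (dist M I σ b) (dist M T τ b)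
         → Step M a (I , σ ∙ call b a) (T , τ ∙ errTo b a e)
    c-bea : ∀ {I T σ τ b e} → Valid (σ ∙ call b a) → Valid (τ ∙ errFrom b e a)
         → rel M a I σ T τ → HEq (dist M I σ b) (swapH e (dist M T τ b))
         → Step M a (I , σ ∙ call b a) (T , τ ∙ errFrom b e a)
    c-other : ∀ {I T σ τ κ κ'} → Valid (σ ∙ κ) → Valid (τ ∙ κ')
         → ¬ Involves a κ → ¬ Involves a κ' → IsCorrect κ'
         → rel M a I σ T τ
         → Step M a (I , σ ∙ κ) (T , τ ∙ κ')

  rel0 : Agent → Init → CallSeq 0 → Init → CallSeq 0 → Set
  rel0 a I ε T ε = I a ≡ T a

  dist0 : Init → CallSeq 0 → Agent → Holding
  dist0 I ε a v = v ≡ (a , I a)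

  distSuc : ∀ {n} → Model n → Init → CallSeq (suc n) → Agent → Holding
  distSuc M I (σ ∙ κ) a = distStep M I σ κ a

  model : (n : ℕ) → Model n
  model zero = record { dist = dist0 ; rel = rel0 }
  model (suc n) = record
    { dist = distSuc (model n)
    ; rel  = λ a I σ T τ → EqClosure (Step (model n) a) (I , σ) (T , τ)
    }

  _,_⊨_ : ∀ {n} → Init → CallSeq n → Formula → Set
  _,_⊨_ {n} I σ φ = sat (model n) φ I σ

  ValidFormula : Formula → Set
  ValidFormula φ = ∀ n (I : Init) (σ : CallSeq n) → Valid σ → I , σ ⊨ φ

{-# OPTIONS --safe #-}
-- Everything agent a ever adds to or removes from its holding is determined by data that a
-- observes: its own previous holding, the holding it receives, and facts about the set of
-- states it cannot distinguish.  Hence, by induction on the length of the call sequence,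
-- ∼_a-related gossip states give a the same holding, which is exactly the claim that a knows
-- which values it holds and which it does not.
module Submission where

open import Defs
open import Data.Nat using (ℕ; _≤_; zero; suc)
open import Data.Bool using (true; false)
open import Data.Bool.Properties using (not-involutive)
open import Data.Maybe using (just; nothing)
open import Data.Product using (_×_; _,_; proj₁; proj₂)
open import Data.Product.Function.NonDependent.Propositional using (_×-⇔_)
open import Data.Sum using (inj₁; inj₂)
open import Data.Sum.Function.Propositional using (_⊎-⇔_)
open import Data.Fin using (_≟_)
open import Function.Base using (_∘_)
open import Function.Bundles using (_⇔_; mk⇔; Equivalence)
open import Function.Related.TypeIsomorphisms using (¬-cong-⇔)
open import Relation.Nullary using (¬_; yes; no)
open import Level using (0ℓ) renaming (suc to lsuc)
open import Relation.Binary.Core using (_=[_]⇒_)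
open import Relation.Binary.Structures using (IsEquivalence)
open import Relation.Binary.Bundles using (Setoid)
import Relation.Binary.Reasoning.Setoid as SetoidReasoning
open import Relation.Binary.PropositionalEquality
  using (_≡_; _≢_; refl; cong; subst; sym; trans; ≡-≟-identity; ≢-≟-identity)
open import Relation.Binary.Construct.Closure.Equivalence as EqClosure using ()

module OwnHolding (k : ℕ) where
  open Gossip k

  HEq-isEquivalence : IsEquivalence HEq
  HEq-isEquivalence = record
    { refl  = λ v → (λ p → p) , (λ p → p)
    ; sym   = λ h v → proj₂ (h v) , proj₁ (h v)
    ; trans = λ h g v → (λ p → proj₁ (g v) (proj₁ (h v) p))
                      , (λ p → proj₂ (h v) (proj₂ (g v) p))
    }

  HEq-setoid : Setoid (lsuc 0ℓ) 0ℓ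
  HEq-setoid = record { isEquivalence = HEq-isEquivalence }

  open IsEquivalence HEq-isEquivalence
    renaming (refl to HEq-refl; sym to HEq-sym; trans to HEq-trans; reflexive to ≡⇒HEq)

  ⇔⇒HEq : ∀ {B B'} → (∀ v → B v ⇔ B' v) → HEq B B'
  ⇔⇒HEq e v = Equivalence.to (e v) , Equivalence.from (e v)

  HEq⇒⇔ : ∀ {B B'} → HEq B B' → ∀ v → B v ⇔ B' v
  HEq⇒⇔ h v = mk⇔ (proj₁ (h v)) (proj₂ (h v))

  swapV-involutive : ∀ c v → swapV c (swapV c v) ≡ v
  swapV-involutive c (d , x) with d ≟ c
  ... | yes d≡c rewrite ≡-≟-identity _≟_ d≡c = cong (d ,_) (not-involutive x)
  ... | no d≢c rewrite ≢-≟-identity _≟_ d≢c = refl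

  tr-involutive : ∀ m B → HEq (tr m (tr m B)) B
  tr-involutive nothing  B = HEq-refl
  tr-involutive (just c) B v =
    subst B (swapV-involutive c v) , subst B (sym (swapV-involutive c v))

  tr-cong : ∀ m {B B'} → HEq B B' → HEq (tr m B) (tr m B')
  tr-cong nothing  h = h
  tr-cong (just c) h v = h (swapV c v)

  HEq-tr-transpose : ∀ m {A B} → HEq A (tr m B) → ∀ X → HEq A X ⇔ HEq B (tr m X)
  HEq-tr-transpose m {B = B} A≈B X = mk⇔
    (λ A≈X → HEq-trans (HEq-sym (tr-involutive m B))
               (tr-cong m (HEq-trans (HEq-sym A≈B) A≈X)))
    (λ B≈X → HEq-trans A≈B (HEq-trans (tr-cong m B≈X) (tr-involutive m X)))

  ∼-sym : ∀ n a {I σ T τ} → rel (model n) a I σ T τ → rel (model n) a T τ I σ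
  ∼-sym zero    a {σ = ε} {τ = ε} = sym
  ∼-sym (suc n) a = EqClosure.symmetric _

  ∼-trans : ∀ n a {I σ T τ U υ} →
    rel (model n) a I σ T τ → rel (model n) a T τ U υ → rel (model n) a I σ U υ
  ∼-trans zero    a {σ = ε} {τ = ε} {υ = ε} = trans
  ∼-trans (suc n) a = EqClosure.transitive _

  K-cong : ∀ n a φ {I σ T τ} → rel (model n) a I σ T τ →
    sat (model n) (K a φ) I σ ⇔ sat (model n) (K a φ) T τ
  K-cong n a φ r = mk⇔
    (λ k T' τ' r' → k T' τ' (∼-trans n a r' (∼-sym n a r)))
    (λ k T' τ' r' → k T' τ' (∼-trans n a r' r))

  -- In every clause of ∼_a the left-hand call is correct, so only the right-hand side may
  -- receive a holding through a transmission error.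
  upd-cong : ∀ n a b m {I σ T τ} → rel (model n) a I σ T τ
    → HEq (dist (model n) I σ a) (dist (model n) T τ a)
    → HEq (dist (model n) I σ b) (tr m (dist (model n) T τ b))
    → HEq (upd (model n) I σ a b nothing) (upd (model n) T τ a b m)
  upd-cong n a b m r own received = ⇔⇒HEq λ where
    (d , x) →
      (HEq⇒⇔ own (d , x) ⊎-⇔ (HEq⇒⇔ received (d , x) ×-⇔ ¬-cong-⇔ (K-cong n a _ r)))
      ×-⇔ ¬-cong-⇔ (mk⇔
        (λ s T' τ' r' h → s T' τ' (∼-trans n a r r')
                            (Equivalence.from (HEq-tr-transpose m received _) h))
        (λ s T' τ' r' h → s T' τ' (∼-trans n a (∼-sym n a r) r')
                            (Equivalence.to (HEq-tr-transpose m received _) h)))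

  module _ {n} (N : Model n) (I : Init) (σ : CallSeq n) where

    call-caller : ∀ x y → distStep N I σ (call x y) x ≡ upd N I σ x y nothing
    call-caller x y rewrite ≡-≟-identity _≟_ (refl {x = x}) = refl

    errFrom-caller : ∀ x c y → distStep N I σ (errFrom x c y) x ≡ upd N I σ x y nothing
    errFrom-caller x c y rewrite ≡-≟-identity _≟_ (refl {x = x}) = refl

    errTo-caller : ∀ x y c → distStep N I σ (errTo x y c) x ≡ upd N I σ x y (just c)
    errTo-caller x y c rewrite ≡-≟-identity _≟_ (refl {x = x}) = refl

    call-callee : ∀ x y → x ≢ y → distStep N I σ (call x y) y ≡ upd N I σ y x nothing
    call-callee x y x≢y
      rewrite ≢-≟-identity _≟_ (x≢y ∘ sym) | ≡-≟-identity _≟_ (refl {x = y}) = refl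

    errFrom-callee : ∀ x c y → x ≢ y → distStep N I σ (errFrom x c y) y ≡ upd N I σ y x (just c)
    errFrom-callee x c y x≢y
      rewrite ≢-≟-identity _≟_ (x≢y ∘ sym) | ≡-≟-identity _≟_ (refl {x = y}) = refl

    errTo-callee : ∀ x y c → x ≢ y → distStep N I σ (errTo x y c) y ≡ upd N I σ y x nothing
    errTo-callee x y c x≢y
      rewrite ≢-≟-identity _≟_ (x≢y ∘ sym) | ≡-≟-identity _≟_ (refl {x = y}) = refl

    uninvolved : ∀ a κ → ¬ Involves a κ → distStep N I σ κ a ≡ dist N I σ a
    uninvolved a (call x y) a∉κ
      rewrite ≢-≟-identity _≟_ (a∉κ ∘ inj₁) | ≢-≟-identity _≟_ (a∉κ ∘ inj₂) = refl
    uninvolved a (errFrom x c y) a∉κ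
      rewrite ≢-≟-identity _≟_ (a∉κ ∘ inj₁) | ≢-≟-identity _≟_ (a∉κ ∘ inj₂) = refl
    uninvolved a (errTo x y c) a∉κ
      rewrite ≢-≟-identity _≟_ (a∉κ ∘ inj₁) | ≢-≟-identity _≟_ (a∉κ ∘ inj₂) = refl

  holdingAt : ∀ n → Agent → GState n → Holding
  holdingAt n a (I , σ) = dist (model n) I σ a

  ∼⇒same-holding : ∀ n a {I σ T τ} → rel (model n) a I σ T τ →
    HEq (holdingAt n a (I , σ)) (holdingAt n a (T , τ))
  Step⇒same-holding : ∀ n a → Step (model n) a =[ holdingAt (suc n) a ]⇒ HEq
  receive-cong : ∀ n a κ κ' b m {I σ T τ}
    → distStep (model n) I σ κ a ≡ upd (model n) I σ a b nothing
    → distStep (model n) T τ κ' a ≡ upd (model n) T τ a b m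
    → rel (model n) a I σ T τ
    → HEq (dist (model n) I σ b) (tr m (dist (model n) T τ b))
    → HEq (distStep (model n) I σ κ a) (distStep (model n) T τ κ' a)

  ∼⇒same-holding zero    a {σ = ε} {τ = ε} Ia≡Ta = ≡⇒HEq (cong (λ x v → v ≡ (a , x)) Ia≡Ta)
  ∼⇒same-holding (suc n) a =
    EqClosure.gfold HEq-isEquivalence (holdingAt (suc n) a) (Step⇒same-holding n a)

  Step⇒same-holding n a (c-ab {I} {T} {σ} {τ} {b} _ _ r h) =
    receive-cong n a (call a b) (call a b) b nothing
      (call-caller (model n) I σ a b)
      (call-caller (model n) T τ a b) r h
  Step⇒same-holding n a (c-aeb {I} {T} {σ} {τ} {b} {e} _ _ r h) =
    receive-cong n a (call a b) (errFrom a e b) b nothing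
      (call-caller (model n) I σ a b)
      (errFrom-caller (model n) T τ a e b) r h
  Step⇒same-holding n a (c-abe {I} {T} {σ} {τ} {b} {e} _ _ r h) =
    receive-cong n a (call a b) (errTo a b e) b (just e)
      (call-caller (model n) I σ a b)
      (errTo-caller (model n) T τ a b e) r h
  Step⇒same-holding n a (c-ba {I} {T} {σ} {τ} {b} ((_ , b≢a) , _) ((_ , b≢a') , _) r h) =
    receive-cong n a (call b a) (call b a) b nothing
      (call-callee (model n) I σ b a b≢a)
      (call-callee (model n) T τ b a b≢a') r h
  Step⇒same-holding n a (c-bae {I} {T} {σ} {τ} {b} {e} ((_ , b≢a) , _) ((_ , b≢a') , _) r h) =
    receive-cong n a (call b a) (errTo b a e) b nothing
      (call-callee (model n) I σ b a b≢a)
      (errTo-callee (model n) T τ b a e b≢a') r h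
  Step⇒same-holding n a (c-bea {I} {T} {σ} {τ} {b} {e} ((_ , b≢a) , _) ((_ , b≢a') , _) r h) =
    receive-cong n a (call b a) (errFrom b e a) b (just e)
      (call-callee (model n) I σ b a b≢a)
      (errFrom-callee (model n) T τ b e a b≢a') r h
  Step⇒same-holding n a (c-other {I} {T} {σ} {τ} {κ} {κ'} _ _ a∉κ a∉κ' _ r) = begin
    distStep (model n) I σ κ a   ≡⟨ uninvolved (model n) I σ a κ a∉κ ⟩
    dist (model n) I σ a         ≈⟨ ∼⇒same-holding n a r ⟩
    dist (model n) T τ a         ≡⟨ uninvolved (model n) T τ a κ' a∉κ' ⟨
    distStep (model n) T τ κ' a  ∎
    where open SetoidReasoning HEq-setoid

  receive-cong n a κ κ' b m {I} {σ} {T} {τ} unfoldI unfoldT r received = begin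
    distStep (model n) I σ κ a     ≡⟨ unfoldI ⟩
    upd (model n) I σ a b nothing  ≈⟨ upd-cong n a b m r (∼⇒same-holding n a r) received ⟩
    upd (model n) T τ a b m        ≡⟨ unfoldT ⟨
    distStep (model n) T τ κ' a    ∎
    where open SetoidReasoning HEq-setoid

  holding-known : ∀ a b x → ValidFormula (sec a b x ⇒' K a (sec a b x))
  holding-known a b x n I σ _ (held , ¬known) =
    ¬known λ T τ r → proj₂ (∼⇒same-holding n a r (b , x)) held

  non-holding-known : ∀ a b x → ValidFormula ((¬' sec a b x) ⇒' K a (¬' sec a b x))
  non-holding-known a b x n I σ _ (¬held , ¬known) =
    ¬known λ T τ r heldThere → ¬held (proj₁ (∼⇒same-holding n a r (b , x)) heldThere)

-- The argument works for any number of agents.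
lemma2 : (k : ℕ) → 2 ≤ k → let open Gossip k in
    (a b : Agent) →
      ValidFormula (sec a b true ⇒' K a (sec a b true))
    × ValidFormula ((¬' sec a b true) ⇒' K a (¬' sec a b true))
    × ValidFormula (sec a b false ⇒' K a (sec a b false))
    × ValidFormula ((¬' sec a b false) ⇒' K a (¬' sec a b false))
lemma2 k _ a b =
  holding-known a b true , non-holding-known a b true ,
  holding-known a b false , non-holding-known a b false
  where open OwnHolding k
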